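{- Let $n\ge3$ and consider the complete graph on $n$ nodes (every pair of distinct nodes joined by an edge), with an arbitrary starting node. Then $$\mathbb E_{\pi_{neg}}[T_C]<\mathbb E_{\pi_{rw}}[T_C].$$
   Context: $T_C$ is the smallest $m$ such that $X_0,\dots,X_m$ visit all nodes of the graph. Random walk $\pi_{rw}$: if $X_m=i$, $X_{m+1}$ is a uniformly random neighbour of $i$, independently of the past. Negative feedback $\pi_{neg}$: for an edge from $i$ to $j$, let $N_{ij}^{(m)}$ be the number of times $t<m$ with $X_t=i,X_{t+1}=j$. Let $Smin_i^{(m)}$ be the set of neighbours $j$ of $i$ minimizing $N_{ij}^{(m)}$. If $X_m=i$, then given the past, $X_{m+1}$ is uniformly distributed on $Smin_i^{(m)}$. -}

module Defs where

open import Data.Bool using (Bool; true; false; if_then_else_; not; _∧_)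
open import Data.Nat as ℕ using (ℕ; zero; suc; _≤ᵇ_; _≡ᵇ_)
open import Data.Fin using (Fin)
open import Data.Fin.Properties using (_≟_)
open import Data.List using (List; []; _∷_; filter; length; allFin; foldr; map)
open import Data.Bool.ListAction using (any; all)
open import Relation.Nullary.Decidable using (T?)
open import Data.Integer using (+_)
open import Data.Rational using (ℚ; 0ℚ; 1ℚ; _/_; _+_; _*_)
open import Relation.Nullary using (¬?)
open import Relation.Nullary.Decidable using (⌊_⌋)

-- Nodes of the complete graph K_n are the elements of Fin n.
-- A trajectory X_0,...,X_m is represented as (current node X_m, list of earlier
-- nodes X_{m-1} ∷ ... ∷ X_0, most recent first).

eqᵇ : {n : ℕ} → Fin n → Fin n → Bool
eqᵇ a b = ⌊ a ≟ b ⌋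

neighbours : {n : ℕ} → Fin n → List (Fin n)
neighbours {n} i = filter (λ j → ¬? (i ≟ j)) (allFin n)

isNeighbour : {n : ℕ} → Fin n → Fin n → Bool
isNeighbour i j = not (eqᵇ i j)

uniform : ℕ → ℚ
uniform zero = 0ℚ
uniform (suc k) = + 1 / suc k

sumℚ : List ℚ → ℚ
sumℚ = foldr _+_ 0ℚ

-- A (history-dependent) policy: given current node, earlier nodes (most recent
-- first) and a candidate next node, the conditional probability of moving there.
Policy : ℕ → Set
Policy n = Fin n → List (Fin n) → Fin n → ℚ

πrw : {n : ℕ} → Policy n
πrw i past j = if isNeighbour i j then uniform (length (neighbours i)) else 0ℚ

-- N_{ab}: number of times t < m with X_t = a, X_{t+1} = b, computed from the
-- reversed full trajectory X_m ∷ X_{m-1} ∷ ... ∷ X_0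
countTrans : {n : ℕ} → Fin n → Fin n → List (Fin n) → ℕ
countTrans a b [] = 0
countTrans a b (y ∷ []) = 0
countTrans a b (y ∷ x ∷ r) =
  (if eqᵇ x a ∧ eqᵇ y b then 1 else 0) ℕ.+ countTrans a b (x ∷ r)

Smin : {n : ℕ} → Fin n → List (Fin n) → List (Fin n)
Smin i past =
  let traj = i ∷ past
      N = λ j → countTrans i j traj
  in filter (λ j → T? (all (λ k → N j ≤ᵇ N k) (neighbours i))) (neighbours i)

elemᵇ : {n : ℕ} → Fin n → List (Fin n) → Bool
elemᵇ v L = any (eqᵇ v) L

πneg : {n : ℕ} → Policy n
πneg i past j =
  if elemᵇ j (Smin i past) then uniform (length (Smin i past)) else 0ℚ

covered : {n : ℕ} → Fin n → List (Fin n) → Bool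
covered {n} i past = all (λ v → elemᵇ v (i ∷ past)) (allFin n)

-- probability, starting from trajectory (i, past), that after k more steps the
-- trajectory has still not covered all nodes
notCoveredAfter : {n : ℕ} → Policy n → ℕ → Fin n → List (Fin n) → ℚ
notCoveredAfter π zero i past = if covered i past then 0ℚ else 1ℚ
notCoveredAfter {n} π (suc k) i past =
  sumℚ (map (λ j → π i past j * notCoveredAfter π k j (i ∷ past)) (allFin n))

tailProb : {n : ℕ} → Policy n → Fin n → ℕ → ℚ
tailProb π s m = notCoveredAfter π m s []

-- partial sums Σ_{m<K} P_π(T_C > m); E_π[T_C] is their supremum
partialExp : {n : ℕ} → Policy n → Fin n → ℕ → ℚ
partialExp π s zero = 0ℚ
partialExp π s (suc K) = partialExp π s K + tailProb π s K

-- Both walks move uniformly within a set of neighbours that contains every unvisited node: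
-- all k = n - 1 neighbours for the random walk, Smin for negative feedback.  Hence the random
-- walk's tail P(T_C > c) depends only on the number u of unvisited nodes, say R c u, and R is
-- increasing in u.  From a state with u + 1 unvisited nodes, one step of either walk against
-- the tails R c gives R c (u+1) - w (R c (u+1) - R c u), where w is the chance of reaching a
-- new node: (u+1)/k for the random walk and (u+1)/|Smin| >= (u+1)/k for negative feedback.
-- By induction the negative-feedback tail is at most R, and strictly so once the walk has gone
-- s -> x -> s, because then Smin at s excludes x.  Finally, until everything is covered,
-- negative feedback only traverses fresh directed edges, so it covers within n^2 steps and its
-- expected cover time is a finite sum.

module Submission where

open import Defs
open import Data.Nat using (ℕ; _≤_)
open import Data.Fin using (Fin)
open import Data.Product using (Σ; _×_)
open import Data.Rational using (ℚ)
open import Data.Rational as Q using ()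

open import Algebra.Bundles using (CommutativeRing)
open import Data.Bool using (Bool; true; false; if_then_else_; not; _∧_; _∨_; T)
import Data.Bool.Properties as Bool
open import Data.Bool.ListAction using (all)
open import Data.Empty using (⊥-elim)
open import Data.Fin using (zero; suc)
open import Data.Fin.Properties using (_≟_)
import Data.Integer as ℤ
import Data.Integer.Solver as ℤ-Solver
open import Data.List using (List; []; _∷_; filter; length; tabulate; map; allFin)
open import Data.Nat as ℕ using (zero; suc; s≤s; z≤n; _<_; _≡ᵇ_; _≤ᵇ_)
import Data.Nat.Properties as ℕ
open import Data.Product using (_,_; proj₂)
open import Data.Rational using (0ℚ; 1ℚ; _+_; _*_; _-_)
import Data.Rational.Properties as ℚ
import Data.Rational.Solver as ℚ-Solver
import Data.Rational.Unnormalised as ℚᵘ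
import Data.Rational.Unnormalised.Properties as ℚᵘ
open import Data.Sum using (inj₁; inj₂)
open import Relation.Binary.PropositionalEquality
open import Relation.Nullary using (¬?; does; yes)
open import Relation.Nullary.Decidable using (isYes≗does; dec-true; dec-false; T?)
open import Relation.Unary using (Pred; Decidable; _∩_)
open import Relation.Unary.Properties using (_∩?_)

open import Algebra.Properties.CommutativeMonoid.Sum ℚ.+-0-commutativeMonoid
  using (sum; sum-syntax; sum-cong-≗; ∑-distrib-+; sum-replicate-zero)
open import Algebra.Properties.CommutativeMonoid.Sum ℕ.+-0-commutativeMonoid
  using () renaming (sum to sumℕ; ∑-distrib-+ to ∑ℕ-distrib-+; sum-cong-≗ to sumℕ-cong-≗)
open import Algebra.Properties.Semiring.Mult (CommutativeRing.semiring ℚ.+-*-commutativeRing)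
  using (×-homo-+; ×-assoc-*) renaming (_×_ to _·_)

*-nonNeg : ∀ {p q} → 0ℚ Q.≤ p → 0ℚ Q.≤ q → 0ℚ Q.≤ p * q
*-nonNeg {p} {q} 0≤p 0≤q =
  ℚ.nonNegative⁻¹ (p * q) {{ℚ.nonNeg*nonNeg⇒nonNeg p {{Q.nonNegative 0≤p}} q {{Q.nonNegative 0≤q}}}}

*-pos : ∀ {p q} → 0ℚ Q.< p → 0ℚ Q.< q → 0ℚ Q.< p * q
*-pos {p} {q} 0<p 0<q = ℚ.positive⁻¹ (p * q) {{ℚ.pos*pos⇒pos p {{Q.positive 0<p}} q {{Q.positive 0<q}}}}

*-monoˡ-≤ : ∀ {r p q} → 0ℚ Q.≤ r → p Q.≤ q → r * p Q.≤ r * q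
*-monoˡ-≤ {r} 0≤r = ℚ.*-monoˡ-≤-nonNeg r {{Q.nonNegative 0≤r}}

*-monoˡ-< : ∀ {r p q} → 0ℚ Q.< r → p Q.< q → r * p Q.< r * q
*-monoˡ-< {r} 0<r = ℚ.*-monoʳ-<-pos r {{Q.positive 0<r}}

sub-nonNeg : ∀ {p q} → p Q.≤ q → 0ℚ Q.≤ q - p
sub-nonNeg {p} p≤q = ℚ.≤-trans (ℚ.≤-reflexive (sym (ℚ.+-inverseʳ p))) (ℚ.+-monoˡ-≤ (Q.- p) p≤q)

sub-pos : ∀ {p q} → p Q.< q → 0ℚ Q.< q - p
sub-pos {p} p<q = ℚ.≤-<-trans (ℚ.≤-reflexive (sym (ℚ.+-inverseʳ p))) (ℚ.+-monoˡ-< (Q.- p) p<q)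

·-monoʳ-≤ : ∀ n {p q} → p Q.≤ q → n · p Q.≤ n · q
·-monoʳ-≤ zero    p≤q = ℚ.≤-refl
·-monoʳ-≤ (suc n) p≤q = ℚ.+-mono-≤ p≤q (·-monoʳ-≤ n p≤q)

·-monoʳ-< : ∀ n {p q} → p Q.< q → suc n · p Q.< suc n · q
·-monoʳ-< n p<q = ℚ.+-mono-<-≤ p<q (·-monoʳ-≤ n (ℚ.<⇒≤ p<q))

·-monoˡ-≤ : ∀ {p} → 0ℚ Q.≤ p → ∀ {m n} → m ≤ n → m · p Q.≤ n · p
·-monoˡ-≤ 0≤p {n = zero}  z≤n = ℚ.≤-refl
·-monoˡ-≤ 0≤p {n = suc n} z≤n = ℚ.+-mono-≤ 0≤p (·-monoˡ-≤ 0≤p {n = n} z≤n)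
·-monoˡ-≤ {p} 0≤p (s≤s m≤n) = ℚ.+-monoʳ-≤ p (·-monoˡ-≤ 0≤p m≤n)

·-monoˡ-< : ∀ {p} → 0ℚ Q.< p → ∀ {m n} → m < n → m · p Q.< n · p
·-monoˡ-< 0<p {zero} {suc n} (s≤s z≤n) = ℚ.+-mono-<-≤ 0<p (·-monoˡ-≤ (ℚ.<⇒≤ 0<p) {n = n} z≤n)
·-monoˡ-< {p} 0<p {suc m} (s≤s m<n) = ℚ.+-monoʳ-< p (·-monoˡ-< 0<p m<n)

toℚᵘ-·1 : ∀ n → Q.toℚᵘ (n · 1ℚ) ℚᵘ.≃ ℚᵘ.mkℚᵘ (ℤ.+ n) 0
toℚᵘ-·1 zero    = ℚᵘ.≃-refl
toℚᵘ-·1 (suc n) = ℚᵘ.≃-trans (ℚ.toℚᵘ-homo-+ 1ℚ (n · 1ℚ))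
  (ℚᵘ.≃-trans (ℚᵘ.+-congʳ (Q.toℚᵘ 1ℚ) (toℚᵘ-·1 n)) (ℚᵘ.*≡* (ℤ-identity (ℤ.+ n))))
  where
  open ℤ-Solver.+-*-Solver
  ℤ-identity : ∀ x → (ℤ.1ℤ ℤ.* ℤ.1ℤ ℤ.+ x ℤ.* ℤ.1ℤ) ℤ.* ℤ.1ℤ ≡ (ℤ.1ℤ ℤ.+ x) ℤ.* (ℤ.1ℤ ℤ.* ℤ.1ℤ)
  ℤ-identity = solve 1 (λ x → (con ℤ.1ℤ :* con ℤ.1ℤ :+ x :* con ℤ.1ℤ) :* con ℤ.1ℤ
                             := (con ℤ.1ℤ :+ x) :* (con ℤ.1ℤ :* con ℤ.1ℤ)) refl

-- uniform (suc m) is fromℚᵘ (mkℚᵘ 1 m), and mkℚᵘ 1 m is the ℚᵘ-inverse of mkℚᵘ (suc m) 0.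
·1-*-uniform : ∀ m → (suc m · 1ℚ) * uniform (suc m) ≡ 1ℚ
·1-*-uniform m = ℚ.toℚᵘ-injective (begin
  Q.toℚᵘ ((suc m · 1ℚ) * u)             ≈⟨ ℚ.toℚᵘ-homo-* (suc m · 1ℚ) u ⟩
  Q.toℚᵘ (suc m · 1ℚ) ℚᵘ.* Q.toℚᵘ u     ≈⟨ ℚᵘ.*-cong (toℚᵘ-·1 (suc m)) (ℚ.toℚᵘ-fromℚᵘ 1/[1+m]) ⟩
  [1+m] ℚᵘ.* 1/[1+m]                    ≈⟨ ℚᵘ.*-inverseʳ [1+m] ⟩
  Q.toℚᵘ 1ℚ                             ∎)
  where
  open ℚᵘ.≃-Reasoning
  u : ℚ
  u = uniform (suc m)
  [1+m] 1/[1+m] : ℚᵘ.ℚᵘ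
  [1+m]   = ℚᵘ.mkℚᵘ (ℤ.+ suc m) 0
  1/[1+m] = ℚᵘ.mkℚᵘ (ℤ.+ 1) m

·-uniform : ∀ m → suc m · uniform (suc m) ≡ 1ℚ
·-uniform m = begin
  suc m · u         ≡⟨ cong (suc m ·_) (sym (ℚ.*-identityˡ u)) ⟩
  suc m · (1ℚ * u)  ≡⟨ sym (×-assoc-* (suc m) 1ℚ u) ⟩
  (suc m · 1ℚ) * u  ≡⟨ ·1-*-uniform m ⟩
  1ℚ                ∎
  where
  open ≡-Reasoning
  u : ℚ
  u = uniform (suc m)

·-nonNeg : ∀ n {p} → 0ℚ Q.≤ p → 0ℚ Q.≤ n · p
·-nonNeg n 0≤p = ·-monoˡ-≤ 0≤p {0} {n} z≤n

·-pos : ∀ n {p} → 0ℚ Q.< p → 0ℚ Q.< suc n · p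
·-pos n 0<p = ·-monoˡ-< 0<p {0} {suc n} (s≤s z≤n)

uniform-pos : ∀ m → 0ℚ Q.< uniform (suc m)
uniform-pos m = ℚ.positive⁻¹ (uniform (suc m)) {{ℚ.normalize-pos 1 (suc m)}}

uniform-nonNeg : ∀ m → 0ℚ Q.≤ uniform m
uniform-nonNeg zero    = ℚ.≤-refl
uniform-nonNeg (suc m) = ℚ.<⇒≤ (uniform-pos m)

uniform-antitone-≤ : ∀ {m m'} → m ≤ m' → uniform (suc m') Q.≤ uniform (suc m)
uniform-antitone-≤ {m} {m'} m≤m' = ℚ.≮⇒≥ λ u<u' → ℚ.<-irrefl refl (begin-strict
  1ℚ                       ≡⟨ sym (·-uniform m) ⟩
  suc m · uniform (suc m)  <⟨ ·-monoʳ-< m u<u' ⟩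
  suc m · uniform (suc m') ≤⟨ ·-monoˡ-≤ (ℚ.<⇒≤ (uniform-pos m')) (s≤s m≤m') ⟩
  suc m' · uniform (suc m') ≡⟨ ·-uniform m' ⟩
  1ℚ                       ∎)
  where open ℚ.≤-Reasoning

uniform-antitone-< : ∀ {m m'} → m < m' → uniform (suc m') Q.< uniform (suc m)
uniform-antitone-< {m} {m'} m<m' = ℚ.≰⇒> λ u≤u' → ℚ.<-irrefl refl (begin-strict
  1ℚ                        ≡⟨ sym (·-uniform m) ⟩
  suc m · uniform (suc m)   ≤⟨ ·-monoʳ-≤ (suc m) u≤u' ⟩
  suc m · uniform (suc m')  <⟨ ·-monoˡ-< (uniform-pos m') (s≤s m<m') ⟩
  suc m' · uniform (suc m') ≡⟨ ·-uniform m' ⟩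
  1ℚ                        ∎)
  where open ℚ.≤-Reasoning

weighted-mean : ∀ x y α a b → (x ℕ.+ y) · α ≡ 1ℚ →
                x · (α * b) + y · (α * a) ≡ b - (y · α) * (b - a)
weighted-mean x y α a b total = begin
  x · (α * b) + y · (α * a)    ≡⟨ sym (cong₂ _+_ (×-assoc-* x α b) (×-assoc-* y α a)) ⟩
  (x · α) * b + (y · α) * a    ≡⟨ cong (λ w → w * b + (y · α) * a) complement ⟩
  (1ℚ - y · α) * b + (y · α) * a ≡⟨ solve 3 (λ w a b → (con 1ℚ :- w) :* b :+ w :* a := b :- w :* (b :- a))
                                            refl (y · α) a b ⟩
  b - (y · α) * (b - a)        ∎
  where
  open ≡-Reasoning
  open ℚ-Solver.+-*-Solver
  complement : x · α ≡ 1ℚ - y · α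
  complement = begin
    x · α                 ≡⟨ solve 2 (λ p q → p := (p :+ q) :- q) refl (x · α) (y · α) ⟩
    (x · α + y · α) - y · α ≡⟨ cong (_- y · α) (trans (sym (×-homo-+ α x y)) total) ⟩
    1ℚ - y · α            ∎

sub-*-antitone-≤ : ∀ b {d w w'} → 0ℚ Q.≤ d → w Q.≤ w' → b - w' * d Q.≤ b - w * d
sub-*-antitone-≤ b {d} 0≤d w≤w' =
  ℚ.+-monoʳ-≤ b (ℚ.neg-antimono-≤ (ℚ.*-monoʳ-≤-nonNeg d {{Q.nonNegative 0≤d}} w≤w'))

sub-*-antitone-< : ∀ b {d w w'} → 0ℚ Q.< d → w Q.< w' → b - w' * d Q.< b - w * d
sub-*-antitone-< b {d} 0<d w<w' =
  ℚ.+-monoʳ-< b (ℚ.neg-antimono-< (ℚ.*-monoˡ-<-pos d {{Q.positive 0<d}} w<w'))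

module RandomWalkTail (k₀ : ℕ) where

  k : ℕ
  k = suc (suc k₀)

  β : ℚ
  β = uniform k

  -- R c u is the chance that the simple random walk on the complete graph with k + 1 nodes
  -- has not covered it within c further steps when u nodes are still unvisited.
  R : ℕ → ℕ → ℚ
  R zero    zero    = 0ℚ
  R zero    (suc u) = 1ℚ
  R (suc c) zero    = 0ℚ
  R (suc c) (suc u) = R c (suc u) - (suc u · β) * (R c (suc u) - R c u)

  ΔR : ℕ → ℕ → ℚ
  ΔR c u = R c (suc u) - R c u

  R-zero : ∀ c → R c 0 ≡ 0ℚ
  R-zero zero    = refl
  R-zero (suc c) = refl

  ΔR-suc-zero : ∀ c → ΔR (suc c) 0 ≡ (1ℚ - β) * ΔR c 0
  ΔR-suc-zero c rewrite R-zero c =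
    -- 1 · β unfolds to β + 0ℚ
    solve 2 (λ r b → (r :- (b :+ con 0ℚ) :* (r :- con 0ℚ)) :- con 0ℚ := (con 1ℚ :- b) :* (r :- con 0ℚ))
      refl (R c 1) β
    where open ℚ-Solver.+-*-Solver

  ΔR-suc-suc : ∀ c u →
    ΔR (suc c) (suc u) ≡ (1ℚ - suc (suc u) · β) * ΔR c (suc u) + (suc u · β) * ΔR c u
  ΔR-suc-suc c u =
    solve 5 (λ r₀ r₁ r₂ w₁ w₂ → (r₂ :- w₂ :* (r₂ :- r₁)) :- (r₁ :- w₁ :* (r₁ :- r₀))
                              := (con 1ℚ :- w₂) :* (r₂ :- r₁) :+ w₁ :* (r₁ :- r₀))
      refl (R c u) (R c (suc u)) (R c (suc (suc u))) (suc u · β) (suc (suc u) · β)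
    where open ℚ-Solver.+-*-Solver

  β-pos : 0ℚ Q.< β
  β-pos = uniform-pos (suc k₀)

  β<1 : β Q.< 1ℚ
  β<1 = uniform-antitone-< {0} {suc k₀} (s≤s z≤n)

  ·β≤1 : ∀ {j} → j ≤ k → j · β Q.≤ 1ℚ
  ·β≤1 j≤k = ℚ.≤-trans (·-monoˡ-≤ (ℚ.<⇒≤ β-pos) j≤k) (ℚ.≤-reflexive (·-uniform (suc k₀)))

  ΔR-nonNeg : ∀ c u → suc u ≤ k → 0ℚ Q.≤ ΔR c u
  ΔR-nonNeg zero    zero    _ = ℚ.nonNegative⁻¹ 1ℚ
  ΔR-nonNeg zero    (suc u) _ = ℚ.≤-refl
  ΔR-nonNeg (suc c) zero    h = ℚ.≤-trans
    (*-nonNeg (sub-nonNeg (ℚ.<⇒≤ β<1)) (ΔR-nonNeg c 0 h))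
    (ℚ.≤-reflexive (sym (ΔR-suc-zero c)))
  ΔR-nonNeg (suc c) (suc u) h = ℚ.≤-trans
    (ℚ.+-mono-≤ (*-nonNeg (sub-nonNeg (·β≤1 h)) (ΔR-nonNeg c (suc u) h))
                (*-nonNeg (·-nonNeg (suc u) (ℚ.<⇒≤ β-pos)) (ΔR-nonNeg c u (ℕ.<⇒≤ h))))
    (ℚ.≤-reflexive (sym (ΔR-suc-suc c u)))

  ΔR-pos : ∀ c u → suc u ≤ k → u ≤ c → 0ℚ Q.< ΔR c u
  ΔR-pos zero    zero    _ _ = ℚ.positive⁻¹ 1ℚ
  ΔR-pos (suc c) zero    h _ = ℚ.<-≤-trans
    (*-pos (sub-pos β<1) (ΔR-pos c 0 h z≤n))
    (ℚ.≤-reflexive (sym (ΔR-suc-zero c)))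
  ΔR-pos (suc c) (suc u) h (s≤s u≤c) = ℚ.<-≤-trans
    (ℚ.+-mono-≤-< (*-nonNeg (sub-nonNeg (·β≤1 h)) (ΔR-nonNeg c (suc u) h))
                  (*-pos (·-pos u β-pos) (ΔR-pos c u (ℕ.<⇒≤ h) u≤c)))
    (ℚ.≤-reflexive (sym (ΔR-suc-suc c u)))

  R-step-≤ : ∀ c u m → suc m ≤ k → suc u ≤ k →
             R c (suc u) - (suc u · uniform (suc m)) * ΔR c u Q.≤ R (suc c) (suc u)
  R-step-≤ c u m m<k u<k = sub-*-antitone-≤ (R c (suc u)) (ΔR-nonNeg c u u<k)
    (·-monoʳ-≤ (suc u) (uniform-antitone-≤ (ℕ.≤-pred m<k)))

  R-step-< : ∀ c u m → suc (suc m) ≤ k → suc u ≤ k → u ≤ c →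
             R c (suc u) - (suc u · uniform (suc m)) * ΔR c u Q.< R (suc c) (suc u)
  R-step-< c u m m<k u<k u≤c = sub-*-antitone-< (R c (suc u)) (ΔR-pos c u u<k u≤c)
    (·-monoʳ-< u (uniform-antitone-< (ℕ.≤-pred m<k)))

sumℕ-mono-≤ : ∀ {n} {f g : Fin n → ℕ} → (∀ j → f j ≤ g j) → sumℕ f ≤ sumℕ g
sumℕ-mono-≤ {zero}  f≤g = z≤n
sumℕ-mono-≤ {suc n} f≤g = ℕ.+-mono-≤ (f≤g zero) (sumℕ-mono-≤ (λ j → f≤g (suc j)))

sumℕ-mono-< : ∀ {n} {f g : Fin n → ℕ} → (∀ j → f j ≤ g j) →
              ∀ j → f j < g j → sumℕ f < sumℕ g
sumℕ-mono-< f≤g zero    f<g = ℕ.+-mono-<-≤ f<g (sumℕ-mono-≤ (λ j → f≤g (suc j)))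
sumℕ-mono-< f≤g (suc j) f<g = ℕ.+-mono-≤-< (f≤g zero) (sumℕ-mono-< (λ j → f≤g (suc j)) j f<g)

sumℕ-≤-* : ∀ {n} {f : Fin n → ℕ} {b} → (∀ j → f j ≤ b) → sumℕ f ≤ n ℕ.* b
sumℕ-≤-* {zero}  f≤b = z≤n
sumℕ-≤-* {suc n} f≤b = ℕ.+-mono-≤ (f≤b zero) (sumℕ-≤-* (λ j → f≤b (suc j)))

∑-mono-≤ : ∀ {n} {f g : Fin n → ℚ} → (∀ j → f j Q.≤ g j) → sum f Q.≤ sum g
∑-mono-≤ {zero}  f≤g = ℚ.≤-refl
∑-mono-≤ {suc n} f≤g = ℚ.+-mono-≤ (f≤g zero) (∑-mono-≤ (λ j → f≤g (suc j)))

∑-mono-< : ∀ {n} {f g : Fin n → ℚ} → (∀ j → f j Q.≤ g j) →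
           ∀ j → f j Q.< g j → sum f Q.< sum g
∑-mono-< f≤g zero    f<g = ℚ.+-mono-<-≤ f<g (∑-mono-≤ (λ j → f≤g (suc j)))
∑-mono-< f≤g (suc j) f<g = ℚ.+-mono-≤-< (f≤g zero) (∑-mono-< (λ j → f≤g (suc j)) j f<g)

∑-zero : ∀ {n} {f : Fin n → ℚ} → (∀ j → f j ≡ 0ℚ) → sum f ≡ 0ℚ
∑-zero {n} f≡0 = trans (sum-cong-≗ f≡0) (sum-replicate-zero n)

∑-nonNeg : ∀ {n} {f : Fin n → ℚ} → (∀ j → 0ℚ Q.≤ f j) → 0ℚ Q.≤ sum f
∑-nonNeg {n} 0≤f = ℚ.≤-trans (ℚ.≤-reflexive (sym (sum-replicate-zero n))) (∑-mono-≤ 0≤f)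

indicator : Bool → ℕ
indicator b = if b then 1 else 0

indicator-mono : ∀ {a b} → (a ≡ true → b ≡ true) → indicator a ≤ indicator b
indicator-mono {false} _   = z≤n
indicator-mono {true}  a⇒b rewrite a⇒b refl = ℕ.≤-refl

count : ∀ {n} → (Fin n → Bool) → ℕ
count A = sumℕ (λ j → indicator (A j))

∑-indicator : ∀ {n} (A : Fin n → Bool) q → ∑[ j < n ] (if A j then q else 0ℚ) ≡ count A · q
∑-indicator {zero}  A q = refl
∑-indicator {suc n} A q with A zero
... | true  = cong (λ r → q + r) (∑-indicator (λ j → A (suc j)) q)
... | false = trans (ℚ.+-identityˡ _) (∑-indicator (λ j → A (suc j)) q)

count-cong : ∀ {n} {A B : Fin n → Bool} → (∀ j → A j ≡ B j) → count A ≡ count B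
count-cong A≡B = sumℕ-cong-≗ (λ j → cong indicator (A≡B j))

count-mono-≤ : ∀ {n} {A B : Fin n → Bool} → (∀ j → A j ≡ true → B j ≡ true) → count A ≤ count B
count-mono-≤ A⊆B = sumℕ-mono-≤ (λ j → indicator-mono (A⊆B j))

count-mono-< : ∀ {n} {A B : Fin n → Bool} → (∀ j → A j ≡ true → B j ≡ true) →
               ∀ j → A j ≡ false → B j ≡ true → count A < count B
count-mono-< A⊆B j Aj Bj = sumℕ-mono-< (λ j → indicator-mono (A⊆B j)) j
  (subst₂ (λ a b → indicator a < indicator b) (sym Aj) (sym Bj) ℕ.≤-refl)

count-split : ∀ {n} (A B : Fin n → Bool) →
              count A ≡ count (λ j → A j ∧ B j) ℕ.+ count (λ j → A j ∧ not (B j))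
count-split A B = trans (sumℕ-cong-≗ pointwise)
  (∑ℕ-distrib-+ (λ j → indicator (A j ∧ B j)) (λ j → indicator (A j ∧ not (B j))))
  where
  pointwise : ∀ j → indicator (A j) ≡ indicator (A j ∧ B j) ℕ.+ indicator (A j ∧ not (B j))
  pointwise j with A j | B j
  ... | true  | true  = refl
  ... | true  | false = refl
  ... | false | _     = refl

count-true : ∀ n → count {n} (λ _ → true) ≡ n
count-true zero    = refl
count-true (suc n) = cong suc (count-true n)

count-false : ∀ n → count {n} (λ _ → false) ≡ 0
count-false zero    = refl
count-false (suc n) = count-false n

count-<-size : ∀ {n} (A : Fin n → Bool) j → A j ≡ false → count A < n
count-<-size {n} A j Aj = subst (count A <_) (count-true n) (count-mono-< (λ _ _ → refl) j Aj refl)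

count-≤-size : ∀ {n} (A : Fin n → Bool) → count A ≤ n
count-≤-size {n} A =
  subst (count A ≤_) (count-true n) (count-mono-≤ {A = A} {B = λ _ → true} (λ _ _ → refl))

count-pos : ∀ {n} (A : Fin n → Bool) j → A j ≡ true → 0 < count A
count-pos {n} A j Aj = subst (_< count A) (count-false n) (count-mono-< (λ _ ()) j refl Aj)

count-witness : ∀ {n} (A : Fin n → Bool) → 0 < count A → Σ (Fin n) λ j → A j ≡ true
count-witness {suc n} A pos with A zero in Azero
... | true  = zero , Azero
... | false = let j , Aj = count-witness (λ j → A (suc j)) pos in suc j , Aj

count-insert : ∀ {n} {A B : Fin n → Bool} j → A j ≡ false → B j ≡ true →
               (∀ i → i ≢ j → A i ≡ B i) → suc (count A) ≡ count B
count-insert zero Aj Bj A≡B rewrite Aj | Bj = cong suc (count-cong (λ i → A≡B (suc i) λ ()))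
count-insert {A = A} {B} (suc j) Aj Bj A≡B rewrite A≡B zero (λ ()) with B zero
... | true  = cong suc (count-insert j Aj Bj (λ i i≢j → A≡B (suc i) (λ { refl → i≢j refl })))
... | false = count-insert j Aj Bj (λ i i≢j → A≡B (suc i) (λ { refl → i≢j refl }))

∑-indicator-product : ∀ {n} (A V : Fin n → Bool) α a b →
  ∑[ j < n ] ((if A j then α else 0ℚ) * (if V j then b else a))
  ≡ count (λ j → A j ∧ V j) · (α * b) + count (λ j → A j ∧ not (V j)) · (α * a)
∑-indicator-product {n} A V α a b = begin
  ∑[ j < n ] ((if A j then α else 0ℚ) * (if V j then b else a))
    ≡⟨ sum-cong-≗ split ⟩
  ∑[ j < n ] ((if A j ∧ V j then α * b else 0ℚ) + (if A j ∧ not (V j) then α * a else 0ℚ))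
    ≡⟨ ∑-distrib-+ (λ j → if A j ∧ V j then α * b else 0ℚ)
                   (λ j → if A j ∧ not (V j) then α * a else 0ℚ) ⟩
  ∑[ j < n ] (if A j ∧ V j then α * b else 0ℚ) + ∑[ j < n ] (if A j ∧ not (V j) then α * a else 0ℚ)
    ≡⟨ cong₂ _+_ (∑-indicator (λ j → A j ∧ V j) (α * b))
                 (∑-indicator (λ j → A j ∧ not (V j)) (α * a)) ⟩
  count (λ j → A j ∧ V j) · (α * b) + count (λ j → A j ∧ not (V j)) · (α * a) ∎
  where
  open ≡-Reasoning
  split : ∀ j → (if A j then α else 0ℚ) * (if V j then b else a)
              ≡ (if A j ∧ V j then α * b else 0ℚ) + (if A j ∧ not (V j) then α * a else 0ℚ)
  split j with A j | V j
  ... | true  | true  = sym (ℚ.+-identityʳ (α * b))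
  ... | true  | false = sym (ℚ.+-identityˡ (α * a))
  ... | false | true  = ℚ.*-zeroˡ b
  ... | false | false = ℚ.*-zeroˡ a

eqᵇ-refl : ∀ {n} (a : Fin n) → eqᵇ a a ≡ true
eqᵇ-refl a = trans (isYes≗does (a ≟ a)) (dec-true (a ≟ a) refl)

≢⇒eqᵇ-false : ∀ {n} {a b : Fin n} → a ≢ b → eqᵇ a b ≡ false
≢⇒eqᵇ-false {a = a} {b} a≢b = trans (isYes≗does (a ≟ b)) (dec-false (a ≟ b) a≢b)

eqᵇ-true⇒≡ : ∀ {n} {a b : Fin n} → eqᵇ a b ≡ true → a ≡ b
eqᵇ-true⇒≡ {a = a} {b} eq with a ≟ b
... | yes a≡b = a≡b

eqᵇ-false⇒≢ : ∀ {n} {a b : Fin n} → eqᵇ a b ≡ false → a ≢ b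
eqᵇ-false⇒≢ {a = a} eq refl with () ← trans (sym eq) (eqᵇ-refl a)

eqᵇ-suc : ∀ {n} (a b : Fin n) → eqᵇ (suc a) (suc b) ≡ eqᵇ a b
eqᵇ-suc a b = trans (isYes≗does (suc a ≟ suc b)) (sym (isYes≗does (a ≟ b)))

eqᵇ-comm : ∀ {n} (a b : Fin n) → eqᵇ a b ≡ eqᵇ b a
eqᵇ-comm a b with eqᵇ a b in a≟b | eqᵇ b a in b≟a
... | true  | true  = refl
... | false | false = refl
... | true  | false = ⊥-elim (eqᵇ-false⇒≢ b≟a (sym (eqᵇ-true⇒≡ a≟b)))
... | false | true  = ⊥-elim (eqᵇ-false⇒≢ a≟b (sym (eqᵇ-true⇒≡ b≟a)))

count-≢ : ∀ {n} (i : Fin (suc n)) → count (λ j → not (eqᵇ i j)) ≡ n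
count-≢ {n}     zero    = count-true n
count-≢ {suc n} (suc i) = cong suc (trans (count-cong (λ j → cong not (eqᵇ-suc i j))) (count-≢ i))

third-node : ∀ {m} (a b : Fin (suc (suc (suc m)))) → Σ (Fin (suc (suc (suc m)))) λ c → c ≢ a × c ≢ b
third-node zero          zero          = suc zero , (λ ()) , (λ ())
third-node zero          (suc zero)    = suc (suc zero) , (λ ()) , (λ ())
third-node zero          (suc (suc _)) = suc zero , (λ ()) , (λ ())
third-node (suc zero)    zero          = suc (suc zero) , (λ ()) , (λ ())
third-node (suc zero)    (suc _)       = zero , (λ ()) , (λ ())
third-node (suc (suc _)) zero          = suc zero , (λ ()) , (λ ())
third-node (suc (suc _)) (suc _)       = zero , (λ ()) , (λ ())

sumℚ-map-tabulate : ∀ {n} {A : Set} (g : Fin n → A) (h : A → ℚ) →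
                    sumℚ (map h (tabulate g)) ≡ ∑[ j < n ] h (g j)
sumℚ-map-tabulate {zero}  g h = refl
sumℚ-map-tabulate {suc n} g h = cong (λ r → h (g zero) + r) (sumℚ-map-tabulate (λ j → g (suc j)) h)

filter-filter : ∀ {a p q} {A : Set a} {P : Pred A p} {Q : Pred A q}
                (P? : Decidable P) (Q? : Decidable Q) xs →
                filter Q? (filter P? xs) ≡ filter (P? ∩? Q?) xs
filter-filter P? Q? []       = refl
filter-filter P? Q? (x ∷ xs) with does (P? x)
... | false = filter-filter P? Q? xs
... | true with does (Q? x)
...   | true  = cong (x ∷_) (filter-filter P? Q? xs)
...   | false = filter-filter P? Q? xs

length-filter-tabulate : ∀ {n p} {A : Set} {P : Pred A p} (P? : Decidable P) (g : Fin n → A) →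
                         length (filter P? (tabulate g)) ≡ count (λ j → does (P? (g j)))
length-filter-tabulate {zero}  P? g = refl
length-filter-tabulate {suc n} P? g with does (P? (g zero))
... | true  = cong suc (length-filter-tabulate P? (λ j → g (suc j)))
... | false = length-filter-tabulate P? (λ j → g (suc j))

elemᵇ-filter : ∀ {n p} {P : Pred (Fin n) p} (P? : Decidable P) j xs →
               elemᵇ j (filter P? xs) ≡ does (P? j) ∧ elemᵇ j xs
elemᵇ-filter P? j []       = sym (Bool.∧-zeroʳ (does (P? j)))
elemᵇ-filter P? j (x ∷ xs) with does (P? x) in Px
... | true with eqᵇ j x in j≟x
...   | false = elemᵇ-filter P? j xs
...   | true rewrite eqᵇ-true⇒≡ j≟x | Px = refl
elemᵇ-filter P? j (x ∷ xs) | false with eqᵇ j x in j≟x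
...   | false = elemᵇ-filter P? j xs
...   | true rewrite eqᵇ-true⇒≡ j≟x | Px = trans (elemᵇ-filter P? x xs) (cong (_∧ elemᵇ x xs) Px)

elemᵇ-tabulate : ∀ {n m} (g : Fin n → Fin m) j → elemᵇ (g j) (tabulate g) ≡ true
elemᵇ-tabulate g zero    rewrite eqᵇ-refl (g zero) = refl
elemᵇ-tabulate g (suc j) = trans (cong (eqᵇ (g (suc j)) (g zero) ∨_) (elemᵇ-tabulate (λ i → g (suc i)) j))
                                 (Bool.∨-zeroʳ _)

elemᵇ-filter-allFin : ∀ {n p} {P : Pred (Fin n) p} (P? : Decidable P) j →
                      elemᵇ j (filter P? (allFin n)) ≡ does (P? j)
elemᵇ-filter-allFin {n} P? j = begin
  elemᵇ j (filter P? (allFin n))     ≡⟨ elemᵇ-filter P? j (allFin n) ⟩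
  does (P? j) ∧ elemᵇ j (allFin n)  ≡⟨ cong (does (P? j) ∧_) (elemᵇ-tabulate (λ i → i) j) ⟩
  does (P? j) ∧ true                ≡⟨ Bool.∧-identityʳ (does (P? j)) ⟩
  does (P? j)                       ∎
  where open ≡-Reasoning

length-filter-allFin : ∀ {n p} {P : Pred (Fin n) p} (P? : Decidable P) →
                       length (filter P? (allFin n)) ≡ count (λ j → elemᵇ j (filter P? (allFin n)))
length-filter-allFin P? = trans (length-filter-tabulate P? (λ j → j))
                                (count-cong (λ j → sym (elemᵇ-filter-allFin P? j)))

all-elim : ∀ {n} (f : Fin n → Bool) xs {y} → all f xs ≡ true → elemᵇ y xs ≡ true → f y ≡ true
all-elim f (x ∷ xs) {y} all-f y∈xs with f x in fx | eqᵇ y x in y≟x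
... | true  | true  rewrite eqᵇ-true⇒≡ y≟x = fx
... | true  | false = all-elim f xs all-f y∈xs

all-intro : ∀ {A : Set} (f : A → Bool) xs → (∀ x → f x ≡ true) → all f xs ≡ true
all-intro f []       _   = refl
all-intro f (x ∷ xs) f-true rewrite f-true x = all-intro f xs f-true

all-tabulate : ∀ {n} {A : Set} (f : A → Bool) (g : Fin n → A) →
               all f (tabulate g) ≡ (count (λ j → not (f (g j))) ≡ᵇ 0)
all-tabulate {zero}  f g = refl
all-tabulate {suc n} f g with f (g zero)
... | true  = all-tabulate f (λ j → g (suc j))
... | false = refl

module CompleteGraph (n₀ : ℕ) where

  open RandomWalkTail n₀ public

  n : ℕ
  n = suc k

  unvisited : List (Fin n) → ℕ
  unvisited T = count (λ v → not (elemᵇ v T))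

  covered-unvisited : ∀ (i : Fin n) past → covered i past ≡ (unvisited (i ∷ past) ≡ᵇ 0)
  covered-unvisited i past = all-tabulate (λ v → elemᵇ v (i ∷ past)) (λ j → j)

  unvisited-revisit : ∀ (j : Fin n) T → elemᵇ j T ≡ true → unvisited (j ∷ T) ≡ unvisited T
  unvisited-revisit j T j∈T = count-cong pointwise
    where
    pointwise : ∀ v → not (eqᵇ v j ∨ elemᵇ v T) ≡ not (elemᵇ v T)
    pointwise v with eqᵇ v j in v≟j
    ... | true  rewrite eqᵇ-true⇒≡ v≟j | j∈T = refl
    ... | false = refl

  unvisited-visit : ∀ (j : Fin n) T → elemᵇ j T ≡ false → suc (unvisited (j ∷ T)) ≡ unvisited T
  unvisited-visit j T j∉T = count-insert j (cong not (cong (_∨ elemᵇ j T) (eqᵇ-refl j))) (cong not j∉T) same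
    where
    same : ∀ v → v ≢ j → not (eqᵇ v j ∨ elemᵇ v T) ≡ not (elemᵇ v T)
    same v v≢j rewrite ≢⇒eqᵇ-false v≢j = refl

  visited-head : ∀ (i : Fin n) past → elemᵇ i (i ∷ past) ≡ true
  visited-head i past = cong (_∨ elemᵇ i past) (eqᵇ-refl i)

  unvisited-≤-k : ∀ (i : Fin n) past → unvisited (i ∷ past) ≤ k
  unvisited-≤-k i past =
    ℕ.≤-pred (count-<-size (λ v → not (elemᵇ v (i ∷ past))) i (cong not (visited-head i past)))

  unvisited-neighbour : ∀ (i : Fin n) past j → elemᵇ j (i ∷ past) ≡ false → isNeighbour i j ≡ true
  unvisited-neighbour i past j j∉T = cong not (≢⇒eqᵇ-false i≢j)
    where
    i≢j : i ≢ j
    i≢j refl with () ← trans (sym (visited-head i past)) j∉T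

  countTrans-unvisited : ∀ (a b : Fin n) T → elemᵇ b T ≡ false → countTrans a b T ≡ 0
  countTrans-unvisited a b []          _   = refl
  countTrans-unvisited a b (y ∷ [])    _   = refl
  countTrans-unvisited a b (y ∷ x ∷ r) b∉T = cong₂ ℕ._+_
    (cong indicator (trans (cong (eqᵇ x a ∧_) y≢b) (Bool.∧-zeroʳ (eqᵇ x a))))
    (countTrans-unvisited a b (x ∷ r) (Bool.∨-conicalʳ (eqᵇ b y) _ b∉T))
    where
    y≢b : eqᵇ y b ≡ false
    y≢b = trans (eqᵇ-comm y b) (Bool.∨-conicalˡ (eqᵇ b y) _ b∉T)

  N : Fin n → List (Fin n) → Fin n → ℕ
  N i past j = countTrans i j (i ∷ past)

  isMinimal : Fin n → List (Fin n) → Fin n → Bool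
  isMinimal i past j = all (λ l → N i past j ≤ᵇ N i past l) (neighbours i)

  inSmin : Fin n → List (Fin n) → Fin n → Bool
  inSmin i past j = elemᵇ j (Smin i past)

  neighbour? : (i : Fin n) → Decidable (λ j → i ≢ j)
  neighbour? i j = ¬? (i ≟ j)

  isNeighbour-elemᵇ : ∀ (i j : Fin n) → elemᵇ j (neighbours i) ≡ isNeighbour i j
  isNeighbour-elemᵇ i j =
    trans (elemᵇ-filter-allFin (neighbour? i) j) (cong not (sym (isYes≗does (i ≟ j))))

  length-neighbours : ∀ (i : Fin n) → length (neighbours i) ≡ k
  length-neighbours i = trans (length-filter-allFin (neighbour? i))
                              (trans (count-cong (isNeighbour-elemᵇ i)) (count-≢ i))

  minimalNeighbour? : ∀ i past → Decidable ((λ j → i ≢ j) ∩ (λ j → T (isMinimal i past j)))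
  minimalNeighbour? i past = neighbour? i ∩? (λ j → T? (isMinimal i past j))

  Smin-filter : ∀ i past → Smin i past ≡ filter (minimalNeighbour? i past) (allFin n)
  Smin-filter i past = filter-filter (neighbour? i) (λ j → T? (isMinimal i past j)) (allFin n)

  inSmin-∧ : ∀ i past j → inSmin i past j ≡ isNeighbour i j ∧ isMinimal i past j
  inSmin-∧ i past j = begin
    elemᵇ j (Smin i past)
      ≡⟨ cong (elemᵇ j) (Smin-filter i past) ⟩
    elemᵇ j (filter (minimalNeighbour? i past) (allFin n))
      ≡⟨ elemᵇ-filter-allFin (minimalNeighbour? i past) j ⟩
    not (does (i ≟ j)) ∧ isMinimal i past j
      ≡⟨ cong (λ b → not b ∧ isMinimal i past j) (sym (isYes≗does (i ≟ j))) ⟩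
    isNeighbour i j ∧ isMinimal i past j
      ∎
    where open ≡-Reasoning

  length-Smin : ∀ i past → length (Smin i past) ≡ count (inSmin i past)
  length-Smin i past = trans (cong length (Smin-filter i past))
    (trans (length-filter-allFin (minimalNeighbour? i past))
           (count-cong (λ j → cong (elemᵇ j) (sym (Smin-filter i past)))))

  Smin⊆neighbours : ∀ i past j → inSmin i past j ≡ true → isNeighbour i j ≡ true
  Smin⊆neighbours i past j j∈S = Bool.∧-conicalˡ _ _ (trans (sym (inSmin-∧ i past j)) j∈S)

  unused-neighbour∈Smin : ∀ i past j → isNeighbour i j ≡ true → N i past j ≡ 0 →
                          inSmin i past j ≡ true
  unused-neighbour∈Smin i past j j∼i unused = trans (inSmin-∧ i past j) (cong₂ _∧_ j∼i minimal)
    where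
    minimal : isMinimal i past j ≡ true
    minimal = all-intro _ (neighbours i) (λ l → cong (_≤ᵇ N i past l) unused)

  unvisited∈Smin : ∀ i past j → elemᵇ j (i ∷ past) ≡ false → inSmin i past j ≡ true
  unvisited∈Smin i past j j∉T = unused-neighbour∈Smin i past j (unvisited-neighbour i past j j∉T)
                                  (countTrans-unvisited i j (i ∷ past) j∉T)

  Smin-unused : ∀ i past {y} → elemᵇ y (i ∷ past) ≡ false →
                ∀ j → inSmin i past j ≡ true → N i past j ≡ 0
  Smin-unused i past {y} y∉T j j∈S =
    ≤ᵇ-zero (N i past j) (subst (λ m → (N i past j ≤ᵇ m) ≡ true) y-unused j≤y)
    where
    y-unused : N i past y ≡ 0
    y-unused = countTrans-unvisited i y (i ∷ past) y∉T
    j≤y : (N i past j ≤ᵇ N i past y) ≡ true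
    j≤y = all-elim _ (neighbours i) (Bool.∧-conicalʳ _ _ (trans (sym (inSmin-∧ i past j)) j∈S))
                     (trans (isNeighbour-elemᵇ i y) (unvisited-neighbour i past y y∉T))
    ≤ᵇ-zero : ∀ m → (m ≤ᵇ 0) ≡ true → m ≡ 0
    ≤ᵇ-zero zero _ = refl

  πrw-on-neighbours : ∀ i past j → πrw i past j ≡ (if isNeighbour i j then β else 0ℚ)
  πrw-on-neighbours i past j rewrite length-neighbours i = refl

  πneg-on-Smin : ∀ i past j →
    πneg i past j ≡ (if inSmin i past j then uniform (count (inSmin i past)) else 0ℚ)
  πneg-on-Smin i past j rewrite length-Smin i past = refl

  πneg-nonNeg : ∀ i past j → 0ℚ Q.≤ πneg i past j
  πneg-nonNeg i past j rewrite πneg-on-Smin i past j with inSmin i past j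
  ... | true  = uniform-nonNeg (count (inSmin i past))
  ... | false = ℚ.≤-refl

  πneg-pos : ∀ i past j → inSmin i past j ≡ true → 0ℚ Q.< πneg i past j
  πneg-pos i past j j∈S rewrite πneg-on-Smin i past j | j∈S
    with count (inSmin i past) | count-pos (inSmin i past) j j∈S
  ... | suc m | _ = uniform-pos m

  Smin-≤-k : ∀ i past → count (inSmin i past) ≤ k
  Smin-≤-k i past = subst (count (inSmin i past) ≤_) (count-≢ i) (count-mono-≤ (Smin⊆neighbours i past))

  Smin-<-k : ∀ i past z → isNeighbour i z ≡ true → inSmin i past z ≡ false → count (inSmin i past) < k
  Smin-<-k i past z z∼i z∉S = subst (count (inSmin i past) <_) (count-≢ i)
                                    (count-mono-< (Smin⊆neighbours i past) z z∉S z∼i)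

  unvisited-pos : ∀ i past {y} → elemᵇ y (i ∷ past) ≡ false → 0 < unvisited (i ∷ past)
  unvisited-pos i past {y} y∉T = count-pos (λ v → not (elemᵇ v (i ∷ past))) y (cong not y∉T)

  unvisited-witness : ∀ i past {u} → unvisited (i ∷ past) ≡ suc u →
                      Σ (Fin n) λ y → elemᵇ y (i ∷ past) ≡ false
  unvisited-witness i past hu
    with count-witness (λ v → not (elemᵇ v (i ∷ past))) (subst (0 <_) (sym hu) (s≤s z≤n))
  ... | y , y∉T = y , Bool.not-injective y∉T

  Smin-nonempty : ∀ i past {y} → elemᵇ y (i ∷ past) ≡ false → 0 < count (inSmin i past)
  Smin-nonempty i past {y} y∉T = count-pos (inSmin i past) y (unvisited∈Smin i past y y∉T)

  tail-step : ∀ (π : Policy n) c i past →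
    notCoveredAfter π (suc c) i past ≡ ∑[ j < n ] (π i past j * notCoveredAfter π c j (i ∷ past))
  tail-step π c i past =
    sumℚ-map-tabulate (λ j → j) (λ j → π i past j * notCoveredAfter π c j (i ∷ past))

  R-next : ∀ c i past {u} → unvisited (i ∷ past) ≡ suc u → ∀ j →
           R c (unvisited (j ∷ i ∷ past)) ≡ (if elemᵇ j (i ∷ past) then R c (suc u) else R c u)
  R-next c i past hu j with elemᵇ j (i ∷ past) in j∈T
  ... | true  = cong (R c) (trans (unvisited-revisit j (i ∷ past) j∈T) hu)
  ... | false = cong (R c) (ℕ.suc-injective (trans (unvisited-visit j (i ∷ past) j∈T) hu))

  uniform-mean : ∀ (A : Fin n → Bool) c i past {u m} → unvisited (i ∷ past) ≡ suc u →
    (∀ j → elemᵇ j (i ∷ past) ≡ false → A j ≡ true) → count A ≡ suc m →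
    ∑[ j < n ] ((if A j then uniform (suc m) else 0ℚ) * R c (unvisited (j ∷ i ∷ past)))
      ≡ R c (suc u) - (suc u · uniform (suc m)) * ΔR c u
  uniform-mean A c i past {u} {m} hu unvisited⊆A |A| = begin
    ∑[ j < n ] ((if A j then α else 0ℚ) * R c (unvisited (j ∷ i ∷ past)))
      ≡⟨ sum-cong-≗ (λ j → cong ((if A j then α else 0ℚ) *_) (R-next c i past hu j)) ⟩
    ∑[ j < n ] ((if A j then α else 0ℚ) * (if V j then b else a))
      ≡⟨ ∑-indicator-product A V α a b ⟩
    x · (α * b) + count (λ j → A j ∧ not (V j)) · (α * a)
      ≡⟨ cong (λ y → x · (α * b) + y · (α * a)) fresh ⟩
    x · (α * b) + suc u · (α * a)
      ≡⟨ weighted-mean x (suc u) α a b total ⟩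
    b - (suc u · α) * (b - a) ∎
    where
    open ≡-Reasoning
    α a b : ℚ
    α = uniform (suc m)
    a = R c u
    b = R c (suc u)
    V : Fin n → Bool
    V j = elemᵇ j (i ∷ past)
    x : ℕ
    x = count (λ j → A j ∧ V j)
    fresh : count (λ j → A j ∧ not (V j)) ≡ suc u
    fresh = trans (count-cong pointwise) hu
      where
      pointwise : ∀ j → A j ∧ not (V j) ≡ not (V j)
      pointwise j with V j in j∈T
      ... | true  = Bool.∧-zeroʳ (A j)
      ... | false rewrite unvisited⊆A j j∈T = refl
    total : (x ℕ.+ suc u) · α ≡ 1ℚ
    total = trans (cong (_· α) (trans (cong (x ℕ.+_) (sym fresh)) (trans (sym (count-split A V)) |A|)))
                  (·-uniform m)

  rw-mean : ∀ c i past {u} → unvisited (i ∷ past) ≡ suc u →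
            ∑[ j < n ] (πrw i past j * R c (unvisited (j ∷ i ∷ past))) ≡ R (suc c) (suc u)
  rw-mean c i past hu =
    trans (sum-cong-≗ (λ j → cong (_* R c (unvisited (j ∷ i ∷ past))) (πrw-on-neighbours i past j)))
          (uniform-mean (isNeighbour i) c i past hu (unvisited-neighbour i past) (count-≢ i))

  neg-mean : ∀ c i past {u m} → unvisited (i ∷ past) ≡ suc u → count (inSmin i past) ≡ suc m →
             ∑[ j < n ] (πneg i past j * R c (unvisited (j ∷ i ∷ past)))
               ≡ R c (suc u) - (suc u · uniform (suc m)) * ΔR c u
  neg-mean c i past {m = m} hu |S| =
    trans (sum-cong-≗ (λ j → cong (_* R c (unvisited (j ∷ i ∷ past))) (weight j)))
          (uniform-mean (inSmin i past) c i past hu (unvisited∈Smin i past) |S|)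
    where
    weight : ∀ j → πneg i past j ≡ (if inSmin i past j then uniform (suc m) else 0ℚ)
    weight j = trans (πneg-on-Smin i past j) (cong (λ w → if inSmin i past j then uniform w else 0ℚ) |S|)

  tail-covered : ∀ (π : Policy n) c i past → unvisited (i ∷ past) ≡ 0 →
                 notCoveredAfter π c i past ≡ 0ℚ
  tail-covered π zero    i past done rewrite covered-unvisited i past | done = refl
  tail-covered π (suc c) i past done = trans (tail-step π c i past) (∑-zero stays-covered)
    where
    stays-covered : ∀ j → π i past j * notCoveredAfter π c j (i ∷ past) ≡ 0ℚ
    stays-covered j with elemᵇ j (i ∷ past) in j∈T
    ... | true  = trans (cong (π i past j *_)
                          (tail-covered π c j (i ∷ past) (trans (unvisited-revisit j (i ∷ past) j∈T) done)))
                        (ℚ.*-zeroʳ (π i past j))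
    ... | false with () ← trans (unvisited-visit j (i ∷ past) j∈T) done

  tail-zero : ∀ (π : Policy n) i past → notCoveredAfter π 0 i past ≡ R 0 (unvisited (i ∷ past))
  tail-zero π i past rewrite covered-unvisited i past with unvisited (i ∷ past)
  ... | zero  = refl
  ... | suc _ = refl

  tail-nonNeg : ∀ (π : Policy n) → (∀ i past j → 0ℚ Q.≤ π i past j) →
                ∀ c i past → 0ℚ Q.≤ notCoveredAfter π c i past
  tail-nonNeg π π≥0 zero i past rewrite tail-zero π i past with unvisited (i ∷ past)
  ... | zero  = ℚ.≤-refl
  ... | suc _ = ℚ.nonNegative⁻¹ 1ℚ
  tail-nonNeg π π≥0 (suc c) i past = ℚ.≤-trans
    (∑-nonNeg (λ j → *-nonNeg (π≥0 i past j) (tail-nonNeg π π≥0 c j (i ∷ past))))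
    (ℚ.≤-reflexive (sym (tail-step π c i past)))

  rw-tail : ∀ c i past → notCoveredAfter πrw c i past ≡ R c (unvisited (i ∷ past))
  rw-tail zero    i past = tail-zero πrw i past
  rw-tail (suc c) i past with unvisited (i ∷ past) in hu
  ... | zero  = tail-covered πrw (suc c) i past hu
  ... | suc u = begin
    notCoveredAfter πrw (suc c) i past                            ≡⟨ tail-step πrw c i past ⟩
    ∑[ j < n ] (πrw i past j * notCoveredAfter πrw c j (i ∷ past))
      ≡⟨ sum-cong-≗ (λ j → cong (πrw i past j *_) (rw-tail c j (i ∷ past))) ⟩
    ∑[ j < n ] (πrw i past j * R c (unvisited (j ∷ i ∷ past)))     ≡⟨ rw-mean c i past hu ⟩
    R (suc c) (suc u)                                             ∎
    where open ≡-Reasoning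

  neg-tail-≤ : ∀ c i past → notCoveredAfter πneg c i past Q.≤ R c (unvisited (i ∷ past))

  neg-term-≤ : ∀ c i past j → πneg i past j * notCoveredAfter πneg c j (i ∷ past)
                               Q.≤ πneg i past j * R c (unvisited (j ∷ i ∷ past))
  neg-term-≤ c i past j = *-monoˡ-≤ (πneg-nonNeg i past j) (neg-tail-≤ c j (i ∷ past))

  neg-mean-≤ : ∀ c i past {u} → unvisited (i ∷ past) ≡ suc u →
               ∑[ j < n ] (πneg i past j * R c (unvisited (j ∷ i ∷ past))) Q.≤ R (suc c) (suc u)
  neg-mean-≤ c i past {u} hu with unvisited-witness i past hu
  ... | y , y∉T with count (inSmin i past) in |S| | Smin-nonempty i past y∉T | Smin-≤-k i past
  ...   | suc m | _ | m<k = ℚ.≤-trans (ℚ.≤-reflexive (neg-mean c i past hu |S|))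
                              (R-step-≤ c u m m<k (subst (_≤ k) hu (unvisited-≤-k i past)))

  neg-tail-≤ zero    i past = ℚ.≤-reflexive (tail-zero πneg i past)
  neg-tail-≤ (suc c) i past with unvisited (i ∷ past) in hu
  ... | zero  = ℚ.≤-reflexive (tail-covered πneg (suc c) i past hu)
  ... | suc u = begin
    notCoveredAfter πneg (suc c) i past                             ≡⟨ tail-step πneg c i past ⟩
    ∑[ j < n ] (πneg i past j * notCoveredAfter πneg c j (i ∷ past)) ≤⟨ ∑-mono-≤ (neg-term-≤ c i past) ⟩
    ∑[ j < n ] (πneg i past j * R c (unvisited (j ∷ i ∷ past)))      ≤⟨ neg-mean-≤ c i past hu ⟩
    R (suc c) (suc u)                                               ∎
    where open ℚ.≤-Reasoning

  neg-tail-<-excluded : ∀ c i past {y} z → elemᵇ y (i ∷ past) ≡ false →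
    unvisited (i ∷ past) ≤ suc c → isNeighbour i z ≡ true → inSmin i past z ≡ false →
    notCoveredAfter πneg (suc c) i past Q.< R (suc c) (unvisited (i ∷ past))
  neg-tail-<-excluded c i past z y∉T few z∼i z∉S
    with unvisited (i ∷ past) in hu | unvisited-pos i past y∉T | few
  ... | suc u | _ | s≤s u≤c
    with count (inSmin i past) in |S| | Smin-nonempty i past y∉T | Smin-<-k i past z z∼i z∉S
  ...   | suc m | _ | m<k = begin-strict
    notCoveredAfter πneg (suc c) i past                             ≡⟨ tail-step πneg c i past ⟩
    ∑[ j < n ] (πneg i past j * notCoveredAfter πneg c j (i ∷ past)) ≤⟨ ∑-mono-≤ (neg-term-≤ c i past) ⟩
    ∑[ j < n ] (πneg i past j * R c (unvisited (j ∷ i ∷ past)))      ≡⟨ neg-mean c i past hu |S| ⟩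
    R c (suc u) - (suc u · uniform (suc m)) * ΔR c u                <⟨ R-step-< c u m m<k u<k u≤c ⟩
    R (suc c) (suc u)                                               ∎
    where
    open ℚ.≤-Reasoning
    u<k : suc u ≤ k
    u<k = subst (_≤ k) hu (unvisited-≤-k i past)

  neg-tail-<-through : ∀ c i past {y} j → elemᵇ y (i ∷ past) ≡ false → inSmin i past j ≡ true →
    notCoveredAfter πneg c j (i ∷ past) Q.< R c (unvisited (j ∷ i ∷ past)) →
    notCoveredAfter πneg (suc c) i past Q.< R (suc c) (unvisited (i ∷ past))
  neg-tail-<-through c i past j y∉T j∈S strict-at-j
    with unvisited (i ∷ past) in hu | unvisited-pos i past y∉T
  ... | suc u | _ = begin-strict
    notCoveredAfter πneg (suc c) i past                             ≡⟨ tail-step πneg c i past ⟩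
    ∑[ j < n ] (πneg i past j * notCoveredAfter πneg c j (i ∷ past))
      <⟨ ∑-mono-< (neg-term-≤ c i past) j (*-monoˡ-< (πneg-pos i past j j∈S) strict-at-j) ⟩
    ∑[ j < n ] (πneg i past j * R c (unvisited (j ∷ i ∷ past)))      ≤⟨ neg-mean-≤ c i past hu ⟩
    R (suc c) (suc u)                                               ∎
    where open ℚ.≤-Reasoning

  untraversed : List (Fin n) → ℕ
  untraversed T = sumℕ (λ a → count (λ b → countTrans a b T ≡ᵇ 0))

  untraversed-≤ : ∀ T → untraversed T ≤ n ℕ.* n
  untraversed-≤ T = sumℕ-≤-* (λ a → count-≤-size (λ b → countTrans a b T ≡ᵇ 0))

  untraversed-decreasing : ∀ i past j → N i past j ≡ 0 →
                           untraversed (j ∷ i ∷ past) < untraversed (i ∷ past)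
  untraversed-decreasing i past j unused =
    sumℕ-mono-< (λ a → count-mono-≤ (stays-unused a)) i
                (count-mono-< (stays-unused i) j now-used was-unused)
    where
    stays-unused : ∀ a b → (countTrans a b (j ∷ i ∷ past) ≡ᵇ 0) ≡ true →
                           (countTrans a b (i ∷ past) ≡ᵇ 0) ≡ true
    stays-unused a b with eqᵇ i a ∧ eqᵇ j b
    ... | false = λ h → h
    now-used : (countTrans i j (j ∷ i ∷ past) ≡ᵇ 0) ≡ false
    now-used rewrite eqᵇ-refl i | eqᵇ-refl j = refl
    was-unused : (countTrans i j (i ∷ past) ≡ᵇ 0) ≡ true
    was-unused rewrite unused = refl

  -- While some node is unvisited, πneg only moves along untraversed edges.
  neg-tail-vanishes : ∀ c i past → untraversed (i ∷ past) < c → notCoveredAfter πneg c i past ≡ 0ℚ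
  neg-tail-vanishes (suc c) i past few with unvisited (i ∷ past) in hu
  ... | zero  = tail-covered πneg (suc c) i past hu
  ... | suc u = trans (tail-step πneg c i past) (∑-zero vanishing)
    where
    vanishing : ∀ j → πneg i past j * notCoveredAfter πneg c j (i ∷ past) ≡ 0ℚ
    vanishing j rewrite πneg-on-Smin i past j with inSmin i past j in j∈S
    ... | false = ℚ.*-zeroˡ (notCoveredAfter πneg c j (i ∷ past))
    ... | true  = trans (cong (uniform (count (inSmin i past)) *_) (neg-tail-vanishes c j (i ∷ past) fewer))
                        (ℚ.*-zeroʳ (uniform (count (inSmin i past))))
      where
      fewer : untraversed (j ∷ i ∷ past) < c
      fewer = ℕ.<-≤-trans
        (untraversed-decreasing i past j (Smin-unused i past (proj₂ (unvisited-witness i past hu)) j j∈S))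
        (ℕ.≤-pred few)

  Smin-after-return : ∀ s x {y} → x ≢ s → elemᵇ y (s ∷ x ∷ s ∷ []) ≡ false →
                      inSmin s (x ∷ s ∷ []) x ≡ false
  Smin-after-return s x {y} x≢s y∉T =
    trans (inSmin-∧ s (x ∷ s ∷ []) x) (trans (cong (isNeighbour s x ∧_) not-minimal) (Bool.∧-zeroʳ _))
    where
    x-used : N s (x ∷ s ∷ []) x ≡ 1
    x-used rewrite ≢⇒eqᵇ-false x≢s | eqᵇ-refl s | eqᵇ-refl x = refl
    y-unused : N s (x ∷ s ∷ []) y ≡ 0
    y-unused = countTrans-unvisited s y (s ∷ x ∷ s ∷ []) y∉T
    y∼s : elemᵇ y (neighbours s) ≡ true
    y∼s = trans (isNeighbour-elemᵇ s y) (unvisited-neighbour s (x ∷ s ∷ []) y y∉T)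
    not-minimal : isMinimal s (x ∷ s ∷ []) x ≡ false
    not-minimal with isMinimal s (x ∷ s ∷ []) x in minimal
    ... | false = refl
    ... | true with () ← trans (sym (cong₂ _≤ᵇ_ x-used y-unused)) (all-elim _ (neighbours s) minimal y∼s)

  -- Going s → x → s uses the edge s → x while a third node y is still fresh, so πneg then
  -- avoids x and beats the random walk strictly; the strict gap propagates back to the start.
  back-and-forth : ∀ s c → k ≤ c →
    notCoveredAfter πneg (suc (suc (suc c))) s [] Q.< R (suc (suc (suc c))) (unvisited (s ∷ []))
  back-and-forth s c k≤c with third-node s s
  ... | x , x≢s , _ with third-node s x
  ...   | y , y≢s , y≢x =
    neg-tail-<-through (suc (suc c)) s [] {y} x y∉T₁ (unvisited∈Smin s [] x x∉T₁)
      (neg-tail-<-through (suc c) x (s ∷ []) {y} s y∉T₂ s∈S₂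
        (neg-tail-<-excluded c s (x ∷ s ∷ []) {y} x y∉T₃ few x∼s (Smin-after-return s x {y} x≢s y∉T₃)))
    where
    y∉T₁ : elemᵇ y (s ∷ []) ≡ false
    y∉T₁ rewrite ≢⇒eqᵇ-false y≢s = refl
    y∉T₂ : elemᵇ y (x ∷ s ∷ []) ≡ false
    y∉T₂ rewrite ≢⇒eqᵇ-false y≢x | ≢⇒eqᵇ-false y≢s = refl
    y∉T₃ : elemᵇ y (s ∷ x ∷ s ∷ []) ≡ false
    y∉T₃ rewrite ≢⇒eqᵇ-false y≢s | ≢⇒eqᵇ-false y≢x = refl
    x∉T₁ : elemᵇ x (s ∷ []) ≡ false
    x∉T₁ rewrite ≢⇒eqᵇ-false x≢s = refl
    s-unused : N x (s ∷ []) s ≡ 0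
    s-unused rewrite ≢⇒eqᵇ-false {a = s} {b = x} (λ s≡x → x≢s (sym s≡x)) = refl
    s∈S₂ : inSmin x (s ∷ []) s ≡ true
    s∈S₂ = unused-neighbour∈Smin x (s ∷ []) s (cong not (≢⇒eqᵇ-false x≢s)) s-unused
    few : unvisited (s ∷ x ∷ s ∷ []) ≤ suc c
    few = ℕ.≤-trans (unvisited-≤-k s (x ∷ s ∷ [])) (ℕ.m≤n⇒m≤1+n k≤c)
    x∼s : isNeighbour s x ≡ true
    x∼s = unvisited-neighbour s [] x x∉T₁

module _ {n : ℕ} (s : Fin n) where

  partialExp-mono : ∀ {π : Policy n} → (∀ m → 0ℚ Q.≤ tailProb π s m) →
                    ∀ {K K'} → K ≤ K' → partialExp π s K Q.≤ partialExp π s K'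
  partialExp-mono tail≥0 {K' = zero}   z≤n = ℚ.≤-refl
  partialExp-mono {π} tail≥0 {K} {suc K'} K≤ with ℕ.m≤n⇒m<n∨m≡n K≤
  ... | inj₂ refl       = ℚ.≤-refl
  ... | inj₁ (s≤s K≤K') = ℚ.≤-trans (partialExp-mono tail≥0 K≤K')
    (ℚ.≤-trans (ℚ.≤-reflexive (sym (ℚ.+-identityʳ (partialExp π s K'))))
               (ℚ.+-monoʳ-≤ (partialExp π s K') (tail≥0 K')))

  partialExp-stable : ∀ {π : Policy n} {M} → (∀ m → M ≤ m → tailProb π s m ≡ 0ℚ) →
                      ∀ {K} → M ≤ K → partialExp π s K ≡ partialExp π s M
  partialExp-stable vanish {zero}  z≤n = refl
  partialExp-stable {π} vanish {suc K} M≤ with ℕ.m≤n⇒m<n∨m≡n M≤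
  ... | inj₂ refl      = refl
  ... | inj₁ (s≤s M≤K) = trans (cong (partialExp π s K +_) (vanish K M≤K))
                               (trans (ℚ.+-identityʳ (partialExp π s K)) (partialExp-stable vanish M≤K))

  partialExp-bounded : ∀ {π : Policy n} {M} → (∀ m → 0ℚ Q.≤ tailProb π s m) →
                       (∀ m → M ≤ m → tailProb π s m ≡ 0ℚ) → ∀ K → partialExp π s K Q.≤ partialExp π s M
  partialExp-bounded {M = M} tail≥0 vanish K with ℕ.≤-total K M
  ... | inj₁ K≤M = partialExp-mono tail≥0 K≤M
  ... | inj₂ M≤K = ℚ.≤-reflexive (partialExp-stable vanish M≤K)

  partialExp-≤ : ∀ {π π' : Policy n} → (∀ m → tailProb π s m Q.≤ tailProb π' s m) →
                 ∀ K → partialExp π s K Q.≤ partialExp π' s K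
  partialExp-≤ tail≤ zero    = ℚ.≤-refl
  partialExp-≤ tail≤ (suc K) = ℚ.+-mono-≤ (partialExp-≤ tail≤ K) (tail≤ K)

  partialExp-< : ∀ {π π' : Policy n} → (∀ m → tailProb π s m Q.≤ tailProb π' s m) →
                 ∀ {m₀} → tailProb π s m₀ Q.< tailProb π' s m₀ →
                 ∀ {K} → m₀ < K → partialExp π s K Q.< partialExp π' s K
  partialExp-< tail≤ {m₀} tail< {suc K} (s≤s m₀≤K) with ℕ.m≤n⇒m<n∨m≡n m₀≤K
  ... | inj₁ m₀<K = ℚ.+-mono-<-≤ (partialExp-< tail≤ tail< m₀<K) (tail≤ K)
  ... | inj₂ refl = ℚ.+-mono-≤-< (partialExp-≤ tail≤ K) tail<

theorem6 : (n : ℕ) → 3 ≤ n → (s : Fin n) →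
    Σ ℕ λ M → Σ ℚ λ q →
      ((K : ℕ) → partialExp πneg s K Q.≤ q) × (q Q.< partialExp πrw s M)
theorem6 (suc (suc (suc n₀))) (s≤s (s≤s (s≤s _))) s = M , partialExp πneg s M , bounded , beaten
  where
  open CompleteGraph n₀
  m₀ M : ℕ
  m₀ = suc (suc (suc k))
  M  = suc (m₀ ℕ.+ n ℕ.* n)
  tails-≤ : ∀ m → tailProb πneg s m Q.≤ tailProb πrw s m
  tails-≤ m = ℚ.≤-trans (neg-tail-≤ m s []) (ℚ.≤-reflexive (sym (rw-tail m s [])))
  tail-< : tailProb πneg s m₀ Q.< tailProb πrw s m₀
  tail-< = ℚ.<-≤-trans (back-and-forth s k ℕ.≤-refl) (ℚ.≤-reflexive (sym (rw-tail m₀ s [])))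
  vanish : ∀ m → M ≤ m → tailProb πneg s m ≡ 0ℚ
  vanish m M≤m = neg-tail-vanishes m s []
    (ℕ.<-≤-trans (s≤s (ℕ.≤-trans (untraversed-≤ (s ∷ [])) (ℕ.m≤n+m (n ℕ.* n) m₀))) M≤m)
  bounded : (K : ℕ) → partialExp πneg s K Q.≤ partialExp πneg s M
  bounded = partialExp-bounded s (λ m → tail-nonNeg πneg πneg-nonNeg m s []) vanish
  beaten : partialExp πneg s M Q.< partialExp πrw s M
  beaten = partialExp-< s tails-≤ tail-< (s≤s (ℕ.m≤m+n m₀ (n ℕ.* n)))
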